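{- Let $k=2^s$ for some $s\in\mathbb{N}$, let $n\ge1$, $A\subset[k]^n$, $j\in[n]$ and $x\in[k]^{n-1}$, and let $A_j^x\subset[k]$ denote the restriction of $A$ to the fibre $a_j^x$, identified with $[k]$. Let $\ell=|A_j^x|$ and $m=|\partial(A_j^x)|$, and suppose $0<\ell\le k/2$. Then $$|\tilde\partial(A_j^x)|\le 6\ell\log_2(mk/\ell).$$
   Context: $[k]=\{1,\dots,k\}$. For $j\in[n]$ and $x\in[k]^{n-1}$, the fibre $a_j^x$ is the set of points of $[k]^n$ obtained by inserting an arbitrary value $y_j\in[k]$ into $x$ at position $j$, identified with $[k]$ via $y\mapsto y_j$. For $S\subset[k]$, $\partial S$ is its edge-boundary in the path graph on $[k]$ (edges $\{y,y+1\}$), so $|\partial S|=|\{y\in[k-1]:1_S(y)\ne1_S(y+1)\}|$. Let $\phi:\{0,1\}^s\to[k]$, $\phi(x_1,\dots,x_s)=1+\sum_{i=1}^sx_i2^{i-1}$, and for $z\in[k]$ let $z_i=(\phi^{ -1}(z))_i$. For $B\subset[k]$, $\tilde\partial(B)$ is the edge-boundary in the cube $\{0,1\}^s$ of $\phi^{ -1}(B)$; equivalently $|\tilde\partial(B)|=\#\{(z,i)\in[k]\times[s]:\ z_i=0,\ 1_B(z)\ne1_B(z+2^{i-1})\}$. -}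

module Defs where

open import Data.Nat using (ℕ; zero; suc; _+_; _*_; _^_; _<_; _∸_)
open import Data.Nat.DivMod using (_/_; _%_)
open import Data.Nat.Properties using (_<?_; _≟_)
open import Data.Bool using (Bool; true; false; if_then_else_; _xor_; not)
open import Data.Fin using (Fin; fromℕ<)
open import Data.List using (List; upTo)
open import Data.Vec.Functional using (insertAt)
open import Relation.Nullary using (yes; no)
open import Relation.Nullary.Decidable using (⌊_⌋)

-- Convention: [k] = {1,…,k} is represented by Fin k = {0,…,k-1} via y ↦ y-1.

countL : (ℕ → Bool) → List ℕ → ℕ
countL p List.[] = 0
countL p (x List.∷ xs) = (if p x then 1 else 0) + countL p xs

at : {k : ℕ} → (Fin k → Bool) → ℕ → Bool
at {k} B y with y <? k
... | yes y<k = B (fromℕ< y<k)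
... | no _ = false

size : {k : ℕ} → (Fin k → Bool) → ℕ
size {k} B = countL (at B) (upTo k)

-- |∂B| : edges {y, y+1} of the path on [k] (0-based: y = 0 … k-2)
pathBoundary : {k : ℕ} → (Fin k → Bool) → ℕ
pathBoundary {k} B = countL (λ y → at B y xor at B (suc y)) (upTo (k ∸ 1))

bit : ℕ → ℕ → ℕ
bit z zero = z % 2
bit z (suc i) = bit (z / 2) i

isZero : ℕ → Bool
isZero zero = true
isZero (suc _) = false

-- |∂̃B| for k = 2^s: pairs (z,i), z ∈ [k] (0-based), i ∈ [s] (0-based),
-- with z_i = 0 and 1_B(z) ≠ 1_B(z + 2^i).
-- (0-based z corresponds to φ^{-1}(z+1) = binary digits of z.)
cubeBoundaryAt : (s : ℕ) → (Fin (2 ^ s) → Bool) → ℕ → ℕ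
cubeBoundaryAt s B i =
  countL (λ z → if isZero (bit z i) then (at B z xor at B (z + 2 ^ i)) else false)
         (upTo (2 ^ s))

sumL : (ℕ → ℕ) → List ℕ → ℕ
sumL f List.[] = 0
sumL f (x List.∷ xs) = f x + sumL f xs

cubeBoundary : (s : ℕ) → (Fin (2 ^ s) → Bool) → ℕ
cubeBoundary s B = sumL (cubeBoundaryAt s B) (upTo s)

fibre : {n' k : ℕ} → ((Fin (suc n') → Fin k) → Bool) →
        Fin (suc n') → (Fin n' → Fin k) → Fin k → Bool
fibre A j x y = A (insertAt x j y)

module Submission where

-- Regard the fibre as a set f ⊆ [0, k) with k = 2^s, and
-- write ℓ = |f|, m = |∂f| (separated edges {y, y+1} of the path) and, for each
-- scale i < s, c_i for the number of cube edges {z, z + 2^i} (bit i of z equal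
-- to 0) separated by f, so that |∂̃f| = Σ_{i<s} c_i.  At every scale
--   (a) c_i ≤ 2ℓ, since every separated pair contains a point of f, and
--   (b) c_i ≤ m·2^i, since a separated pair {z, z + 2^i} is separated by one of
--       the 2^i path edges between z and z + 2^i (telescoping), while each
--       path edge lies in at most 2^i of these windows.
-- Moreover m ≥ 1 because 0 < ℓ < k, hence 2ℓ ≤ k ≤ m·2^s.  A numerical lemma
-- turns c_i ≤ min(2ℓ, m·2^i) into 2^{Σ c_i}·ℓ^{6ℓ} ≤ (m·2^s)^{6ℓ}: going down
-- from the top scale, each scale with 2ℓ ≤ m·2^i costs at most 6ℓ in the
-- exponent and is paid for by halving m·2^s, and the remaining scales sum
-- geometrically to less than 4ℓ.
-- The file develops finite sums, the path-boundary facts for an arbitrary set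
-- of naturals below k, the binary-digit fact behind (b), the numerical lemma,
-- and finally translates the list-based counts of Defs into these sums.

open import Defs
open import Data.Nat using (ℕ; suc; _+_; _*_; _^_; _<_; _≤_)
open import Data.Fin using (Fin)
open import Data.Bool using (Bool)

open import Data.Nat using (zero; _∸_; z≤n; z<s; s<s)
open import Data.Nat.Properties
open import Data.Nat.DivMod using (_/_; _%_; m≡m%n+[m/n]*n; m%n<n; m<n*o⇒m/o<n)
open import Data.Nat.Tactic.RingSolver using (solve-∀)
open import Algebra.Properties.CommutativeSemigroup +-commutativeSemigroup
  using () renaming (interchange to +-interchange; xy∙z≈xz∙y to +-right-comm)
open import Algebra.Properties.CommutativeSemigroup *-commutativeSemigroup
  using () renaming (interchange to *-interchange)
open import Data.Bool using (true; false; _xor_; if_then_else_)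
open import Data.List using (applyUpTo)
open import Data.Sum using (inj₁; inj₂)
open import Data.Empty using (⊥-elim)
open import Relation.Nullary using (yes; no)
open import Relation.Binary.PropositionalEquality

𝟙 : Bool → ℕ
𝟙 b = if b then 1 else 0

𝟙≤1 : ∀ b → 𝟙 b ≤ 1
𝟙≤1 true = ≤-refl
𝟙≤1 false = z≤n

∑ : ℕ → (ℕ → ℕ) → ℕ
∑ zero g = 0
∑ (suc n) g = g 0 + ∑ n (λ x → g (suc x))

∑-cong : ∀ n {g h : ℕ → ℕ} → (∀ x → x < n → g x ≡ h x) → ∑ n g ≡ ∑ n h
∑-cong zero g≡h = refl
∑-cong (suc n) g≡h =
  cong₂ _+_ (g≡h 0 z<s) (∑-cong n (λ x x<n → g≡h (suc x) (s<s x<n)))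

∑-mono : ∀ n {g h : ℕ → ℕ} → (∀ x → x < n → g x ≤ h x) → ∑ n g ≤ ∑ n h
∑-mono zero g≤h = z≤n
∑-mono (suc n) g≤h =
  +-mono-≤ (g≤h 0 z<s) (∑-mono n (λ x x<n → g≤h (suc x) (s<s x<n)))

∑-const : ∀ n c → ∑ n (λ _ → c) ≡ n * c
∑-const zero c = refl
∑-const (suc n) c = cong (c +_) (∑-const n c)

∑-zero : ∀ n → ∑ n (λ _ → 0) ≡ 0
∑-zero n = trans (∑-const n 0) (*-zeroʳ n)

∑-+ : ∀ n (g h : ℕ → ℕ) → ∑ n (λ x → g x + h x) ≡ ∑ n g + ∑ n h
∑-+ zero g h = refl
∑-+ (suc n) g h =
  trans (cong (g 0 + h 0 +_) (∑-+ n (λ x → g (suc x)) (λ x → h (suc x))))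
        (+-interchange (g 0) (h 0) _ _)

∑-snoc : ∀ n (g : ℕ → ℕ) → ∑ (suc n) g ≡ ∑ n g + g n
∑-snoc zero g = +-identityʳ (g 0)
∑-snoc (suc n) g =
  trans (cong (g 0 +_) (∑-snoc n (λ x → g (suc x)))) (sym (+-assoc (g 0) _ _))

∑-split : ∀ c n (g : ℕ → ℕ) → ∑ (c + n) g ≡ ∑ c g + ∑ n (λ x → g (c + x))
∑-split zero n g = refl
∑-split (suc c) n g =
  trans (cong (g 0 +_) (∑-split c n (λ x → g (suc x)))) (sym (+-assoc (g 0) _ _))

∑-swap : ∀ n a (g : ℕ → ℕ → ℕ) →
  ∑ n (λ x → ∑ a (g x)) ≡ ∑ a (λ d → ∑ n (λ x → g x d))
∑-swap zero a g = sym (∑-zero a)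
∑-swap (suc n) a g =
  trans (cong (∑ a (g 0) +_) (∑-swap n a (λ x → g (suc x))))
        (sym (∑-+ a (g 0) (λ d → ∑ n (λ x → g (suc x) d))))

∑-window : ∀ c n (g : ℕ → ℕ) → ∑ n (λ x → g (c + x)) ≤ ∑ (c + n) g
∑-window c n g = ≤-trans (m≤n+m _ (∑ c g)) (≤-reflexive (sym (∑-split c n g)))

∑-prefix : ∀ {M N} (g : ℕ → ℕ) → M ≤ N → ∑ M g ≤ ∑ N g
∑-prefix {M} {N} g M≤N = begin
  ∑ M g                ≤⟨ m≤m+n _ _ ⟩
  ∑ M g + ∑ (N ∸ M) _  ≡⟨ sym (∑-split M (N ∸ M) g) ⟩
  ∑ (M + (N ∸ M)) g    ≡⟨ cong (λ t → ∑ t g) (m+[n∸m]≡n M≤N) ⟩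
  ∑ N g                ∎
  where open ≤-Reasoning

∑-beyond-support : ∀ {M N} (g : ℕ → ℕ) → (∀ y → N ≤ y → g y ≡ 0) → N ≤ M →
  ∑ M g ≡ ∑ N g
∑-beyond-support {M} {N} g vanish N≤M = begin
  ∑ M g                                ≡⟨ cong (λ t → ∑ t g) (sym (m+[n∸m]≡n N≤M)) ⟩
  ∑ (N + (M ∸ N)) g                    ≡⟨ ∑-split N (M ∸ N) g ⟩
  ∑ N g + ∑ (M ∸ N) (λ x → g (N + x))  ≡⟨ cong (∑ N g +_) tail≡0 ⟩
  ∑ N g + 0                            ≡⟨ +-identityʳ _ ⟩
  ∑ N g                                ∎
  where
    open ≡-Reasoning
    tail≡0 : ∑ (M ∸ N) (λ x → g (N + x)) ≡ 0
    tail≡0 = trans (∑-cong (M ∸ N) (λ x _ → vanish (N + x) (m≤m+n N x))) (∑-zero (M ∸ N))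

∑≤total : ∀ M N (g : ℕ → ℕ) → (∀ y → N ≤ y → g y ≡ 0) → ∑ M g ≤ ∑ N g
∑≤total M N g vanish with ≤-total M N
... | inj₁ M≤N = ∑-prefix g M≤N
... | inj₂ N≤M = ≤-reflexive (∑-beyond-support g vanish N≤M)

∑-shift≤total : ∀ c n N (g : ℕ → ℕ) → (∀ y → N ≤ y → g y ≡ 0) →
  ∑ n (λ x → g (x + c)) ≤ ∑ N g
∑-shift≤total c n N g vanish = begin
  ∑ n (λ x → g (x + c))  ≡⟨ ∑-cong n (λ x _ → cong g (+-comm x c)) ⟩
  ∑ n (λ x → g (c + x))  ≤⟨ ∑-window c n g ⟩
  ∑ (c + n) g            ≤⟨ ∑≤total (c + n) N g vanish ⟩
  ∑ N g                  ∎
  where open ≤-Reasoning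

differ : (ℕ → Bool) → ℕ → ℕ → ℕ
differ f a b = 𝟙 (f a xor f b)

xor-triangle : ∀ x y z → 𝟙 (x xor z) ≤ 𝟙 (x xor y) + 𝟙 (y xor z)
xor-triangle true true z = ≤-refl
xor-triangle false false z = ≤-refl
xor-triangle true false z = ≤-trans (𝟙≤1 _) (m≤m+n 1 _)
xor-triangle false true z = ≤-trans (𝟙≤1 _) (m≤m+n 1 _)

xor-self : ∀ x → 𝟙 (x xor x) ≡ 0
xor-self true = refl
xor-self false = refl

xor-unseparated : ∀ x y → 𝟙 (x xor y) ≤ 0 → x ≡ y
xor-unseparated true true _ = refl
xor-unseparated false false _ = refl
xor-unseparated true false ()
xor-unseparated false true ()

xor≤members : ∀ x y → 𝟙 (x xor y) ≤ 𝟙 x + 𝟙 y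
xor≤members true y = ≤-trans (𝟙≤1 _) (m≤m+n 1 (𝟙 y))
xor≤members false y = ≤-refl

edge : (ℕ → Bool) → ℕ → ℕ
edge f y = differ f y (suc y)

differ≤edges : ∀ f a n → differ f a (a + n) ≤ ∑ n (λ d → edge f (a + d))
differ≤edges f a zero rewrite +-identityʳ a = ≤-reflexive (xor-self (f a))
differ≤edges f a (suc n) rewrite +-suc a n = begin
  differ f a (suc (a + n))                     ≤⟨ xor-triangle (f a) (f (a + n)) _ ⟩
  differ f a (a + n) + edge f (a + n)          ≤⟨ +-monoˡ-≤ _ (differ≤edges f a n) ⟩
  ∑ n (λ d → edge f (a + d)) + edge f (a + n)  ≡⟨ sym (∑-snoc n (λ d → edge f (a + d))) ⟩
  ∑ (suc n) (λ d → edge f (a + d))             ∎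
  where open ≤-Reasoning

pathEdge : ℕ → (ℕ → Bool) → ℕ → ℕ
pathEdge K f y with y <? K
... | yes _ = edge f y
... | no _ = 0

pathEdge-inside : ∀ K f {y} → y < K → pathEdge K f y ≡ edge f y
pathEdge-inside K f {y} y<K with y <? K
... | yes _ = refl
... | no y≮K = ⊥-elim (y≮K y<K)

pathEdge-outside : ∀ K f y → K ≤ y → pathEdge K f y ≡ 0
pathEdge-outside K f y K≤y with y <? K
... | yes y<K = ⊥-elim (<⇒≱ y<K K≤y)
... | no _ = refl

module PathSet (k : ℕ) (f : ℕ → Bool) where

  K : ℕ
  K = k ∸ 1

  volume : ℕ
  volume = ∑ k (λ y → 𝟙 (f y))

  boundary : ℕ
  boundary = ∑ K (edge f)

  differ≤boundary : ∀ a n → a + n ≤ K → differ f a (a + n) ≤ boundary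
  differ≤boundary a n a+n≤K =
    ≤-trans (differ≤edges f a n) (≤-trans (∑-window a n (edge f)) (∑-prefix (edge f) a+n≤K))

  constant-without-boundary : boundary ≡ 0 → ∀ y → y < k → f y ≡ f 0
  constant-without-boundary b≡0 y y<k =
    sym (xor-unseparated (f 0) (f y)
      (subst (differ f 0 y ≤_) b≡0 (differ≤boundary 0 y (<⇒≤pred y<k))))

  volume-without-boundary : boundary ≡ 0 → volume ≡ k * 𝟙 (f 0)
  volume-without-boundary b≡0 =
    trans (∑-cong k (λ y y<k → cong 𝟙 (constant-without-boundary b≡0 y y<k)))
          (∑-const k (𝟙 (f 0)))

  boundary-pos : 0 < volume → volume < k → 0 < boundary
  boundary-pos nonempty proper with boundary ≟ 0
  ... | no b≢0 = n≢0⇒n>0 b≢0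
  ... | yes b≡0 with f 0 | volume-without-boundary b≡0
  ...   | true  | vol≡k*1 = ⊥-elim (<-irrefl (trans vol≡k*1 (*-identityʳ k)) proper)
  ...   | false | vol≡k*0 = ⊥-elim (<-irrefl (sym (trans vol≡k*0 (*-zeroʳ k))) nonempty)

  -- (a): if f ⊆ [0, k), then among the pairs {z, z + t} with z < k at most
  -- 2·volume are separated, each one containing a point of f.
  shiftedPairs≤2volume : (∀ y → k ≤ y → f y ≡ false) →
    ∀ t → ∑ k (λ z → differ f z (z + t)) ≤ 2 * volume
  shiftedPairs≤2volume bounded t = begin
    ∑ k (λ z → differ f z (z + t))               ≤⟨ ∑-mono k (λ z _ → xor≤members (f z) (f (z + t))) ⟩
    ∑ k (λ z → 𝟙 (f z) + 𝟙 (f (z + t)))          ≡⟨ ∑-+ k (λ z → 𝟙 (f z)) (λ z → 𝟙 (f (z + t))) ⟩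
    volume + ∑ k (λ z → 𝟙 (f (z + t)))           ≤⟨ +-monoʳ-≤ volume shifted≤ ⟩
    volume + volume                              ≡⟨ cong (volume +_) (sym (+-identityʳ volume)) ⟩
    2 * volume                                   ∎
    where
      open ≤-Reasoning
      shifted≤ : ∑ k (λ z → 𝟙 (f (z + t))) ≤ volume
      shifted≤ = ∑-shift≤total t k k (λ y → 𝟙 (f y)) (λ y k≤y → cong 𝟙 (bounded y k≤y))

  differ≤window : ∀ a n → a + n ≤ K → differ f a (a + n) ≤ ∑ n (λ d → pathEdge K f (a + d))
  differ≤window a n a+n≤K =
    ≤-trans (differ≤edges f a n)
      (≤-reflexive (∑-cong n (λ d d<n →
        sym (pathEdge-inside K f (<-≤-trans (+-monoʳ-< a d<n) a+n≤K)))))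

  -- (b), abstractly: if each of the k terms g z is bounded by the window of
  -- w path edges starting at z, the total is at most boundary·w, since every
  -- path edge lies in at most w windows.
  windowed≤ : ∀ w (g : ℕ → ℕ) →
    (∀ z → z < k → g z ≤ ∑ w (λ d → pathEdge K f (z + d))) → ∑ k g ≤ boundary * w
  windowed≤ w g g≤window = begin
    ∑ k g                                          ≤⟨ ∑-mono k g≤window ⟩
    ∑ k (λ z → ∑ w (λ d → pathEdge K f (z + d)))   ≡⟨ ∑-swap k w (λ z d → pathEdge K f (z + d)) ⟩
    ∑ w (λ d → ∑ k (λ z → pathEdge K f (z + d)))   ≤⟨ ∑-mono w (λ d _ → edgesInWindows d) ⟩
    ∑ w (λ _ → boundary)                           ≡⟨ ∑-const w boundary ⟩
    w * boundary                                   ≡⟨ *-comm w boundary ⟩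
    boundary * w                                   ∎
    where
      open ≤-Reasoning
      cutBoundary : ∑ K (pathEdge K f) ≡ boundary
      cutBoundary = ∑-cong K (λ y y<K → pathEdge-inside K f y<K)
      edgesInWindows : ∀ d → ∑ k (λ z → pathEdge K f (z + d)) ≤ boundary
      edgesInWindows d =
        ≤-trans (∑-shift≤total d k K (pathEdge K f) (pathEdge-outside K f))
                (≤-reflexive cutBoundary)

halve : ∀ z → z ≡ 2 * (z / 2) + z % 2
halve z = trans (m≡m%n+[m/n]*n z 2) (trans (+-comm (z % 2) _) (cong (_+ z % 2) (*-comm (z / 2) 2)))

halve-< : ∀ z {t} → z < 2 * t → z / 2 < t
halve-< z {t} z<2t = m<n*o⇒m/o<n (subst (z <_) (*-comm 2 t) z<2t)

appendBit-< : ∀ {q r t} → r ≤ 1 → q < t → 2 * q + r < 2 * t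
appendBit-< {q} {r} {t} r≤1 q<t = begin-strict
  2 * q + r  ≤⟨ +-monoʳ-≤ (2 * q) r≤1 ⟩
  2 * q + 1  <⟨ +-monoʳ-< (2 * q) (n<1+n 1) ⟩
  2 * q + 2  ≡⟨ +-comm (2 * q) 2 ⟩
  2 + 2 * q  ≡⟨ *-suc 2 q ⟨
  2 * suc q  ≤⟨ *-monoʳ-≤ 2 q<t ⟩
  2 * t      ∎
  where open ≤-Reasoning

setBit-< : ∀ s i z → i < s → z < 2 ^ s → bit z i ≡ 0 → z + 2 ^ i < 2 ^ s
setBit-< (suc s) zero z _ z<2^s bit≡0 = begin-strict
  z + 1                    ≡⟨ cong (_+ 1) (halve z) ⟩
  2 * (z / 2) + z % 2 + 1  ≡⟨ cong (λ r → 2 * (z / 2) + r + 1) bit≡0 ⟩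
  2 * (z / 2) + 0 + 1      ≡⟨ cong (_+ 1) (+-identityʳ _) ⟩
  2 * (z / 2) + 1          <⟨ appendBit-< ≤-refl (halve-< z {2 ^ s} z<2^s) ⟩
  2 * 2 ^ s                ∎
  where open ≤-Reasoning
setBit-< (suc s) (suc i) z (s<s i<s) z<2^s bit≡0 = begin-strict
  z + 2 * 2 ^ i                    ≡⟨ cong (_+ 2 * 2 ^ i) (halve z) ⟩
  2 * (z / 2) + z % 2 + 2 * 2 ^ i  ≡⟨ regroup (z / 2) (z % 2) (2 ^ i) ⟩
  2 * (z / 2 + 2 ^ i) + z % 2      <⟨ appendBit-< (≤-pred (m%n<n z 2)) higherBits-< ⟩
  2 * 2 ^ s                        ∎
  where
    open ≤-Reasoning
    higherBits-< : z / 2 + 2 ^ i < 2 ^ s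
    higherBits-< = setBit-< s i (z / 2) i<s (halve-< z {2 ^ s} z<2^s) bit≡0
    regroup : ∀ q r p → 2 * q + r + 2 * p ≡ 2 * (q + p) + r
    regroup = solve-∀

crossing : (ℕ → Bool) → ℕ → ℕ → ℕ
crossing f i z = 𝟙 (if isZero (bit z i) then (f z xor f (z + 2 ^ i)) else false)

crossing≤differ : ∀ f i z → crossing f i z ≤ differ f z (z + 2 ^ i)
crossing≤differ f i z with isZero (bit z i)
... | true = ≤-refl
... | false = z≤n

-- The same set f viewed inside the cube {0,1}^s ≅ [0, 2^s) via binary digits.
module CubeSet (s : ℕ) (f : ℕ → Bool) where
  open PathSet (2 ^ s) f public

  crossings : ℕ → ℕ
  crossings i = ∑ (2 ^ s) (crossing f i)

  crossings≤2volume : (∀ y → 2 ^ s ≤ y → f y ≡ false) → ∀ i → crossings i ≤ 2 * volume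
  crossings≤2volume bounded i =
    ≤-trans (∑-mono (2 ^ s) (λ z _ → crossing≤differ f i z))
            (shiftedPairs≤2volume bounded (2 ^ i))

  crossing≤window : ∀ i → i < s → ∀ z → z < 2 ^ s →
    crossing f i z ≤ ∑ (2 ^ i) (λ d → pathEdge K f (z + d))
  crossing≤window i i<s z z<2^s with bit z i in bit≡
  ... | zero = differ≤window z (2 ^ i) (<⇒≤pred (setBit-< s i z i<s z<2^s bit≡))
  ... | suc _ = z≤n

  crossings≤boundary : ∀ i → i < s → crossings i ≤ boundary * 2 ^ i
  crossings≤boundary i i<s = windowed≤ (2 ^ i) (crossing f i) (crossing≤window i i<s)

^-distribʳ-* : ∀ a b n → (a * b) ^ n ≡ a ^ n * b ^ n
^-distribʳ-* a b zero = refl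
^-distribʳ-* a b (suc n) =
  trans (cong (a * b *_) (^-distribʳ-* a b n)) (*-interchange a b (a ^ n) (b ^ n))

saturated : ∀ e ℓ M → e ≤ 6 * ℓ → 2 * ℓ ≤ M → 2 ^ e * ℓ ^ (6 * ℓ) ≤ M ^ (6 * ℓ)
saturated e ℓ M e≤6ℓ 2ℓ≤M = begin
  2 ^ e * ℓ ^ (6 * ℓ)        ≤⟨ *-monoˡ-≤ (ℓ ^ (6 * ℓ)) (^-monoʳ-≤ 2 e≤6ℓ) ⟩
  2 ^ (6 * ℓ) * ℓ ^ (6 * ℓ)  ≡⟨ ^-distribʳ-* 2 ℓ (6 * ℓ) ⟨
  (2 * ℓ) ^ (6 * ℓ)          ≤⟨ ^-monoˡ-≤ (6 * ℓ) 2ℓ≤M ⟩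
  M ^ (6 * ℓ)                ∎
  where open ≤-Reasoning

doubling : ∀ a b ℓ M → b ≤ 6 * ℓ → 2 ^ a * ℓ ^ (6 * ℓ) ≤ M ^ (6 * ℓ) →
  2 ^ (a + b) * ℓ ^ (6 * ℓ) ≤ (2 * M) ^ (6 * ℓ)
doubling a b ℓ M b≤6ℓ IH = begin
  2 ^ (a + b) * L            ≡⟨ cong (_* L) (^-distribˡ-+-* 2 a b) ⟩
  2 ^ a * 2 ^ b * L          ≡⟨ cong (_* L) (*-comm (2 ^ a) (2 ^ b)) ⟩
  2 ^ b * 2 ^ a * L          ≡⟨ *-assoc (2 ^ b) (2 ^ a) L ⟩
  2 ^ b * (2 ^ a * L)        ≤⟨ *-mono-≤ (^-monoʳ-≤ 2 b≤6ℓ) IH ⟩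
  2 ^ (6 * ℓ) * M ^ (6 * ℓ)  ≡⟨ ^-distribʳ-* 2 M (6 * ℓ) ⟨
  (2 * M) ^ (6 * ℓ)          ∎
  where
    open ≤-Reasoning
    L = ℓ ^ (6 * ℓ)

-- Passing from scale 2^{s+1} = 2·2^s to scale 2^s.
twice : ∀ m p → m * (2 * p) ≡ 2 * (m * p)
twice = solve-∀

lowerScales : ∀ {s} {P : ℕ → Set} → (∀ i → i < suc s → P i) → ∀ i → i < s → P i
lowerScales bound i i<s = bound i (m<n⇒m<1+n i<s)

geometric : ∀ m s (c : ℕ → ℕ) → (∀ i → i < s → c i ≤ m * 2 ^ i) → ∑ s c + m ≤ m * 2 ^ s
geometric m zero c _ = ≤-reflexive (sym (*-identityʳ m))
geometric m (suc s) c c≤ = begin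
  ∑ (suc s) c + m            ≡⟨ cong (_+ m) (∑-snoc s c) ⟩
  ∑ s c + c s + m            ≡⟨ +-right-comm (∑ s c) (c s) m ⟩
  ∑ s c + m + c s            ≤⟨ +-mono-≤ (geometric m s c (lowerScales c≤)) (c≤ s (n<1+n s)) ⟩
  m * 2 ^ s + m * 2 ^ s      ≡⟨ cong (m * 2 ^ s +_) (+-identityʳ (m * 2 ^ s)) ⟨
  2 * (m * 2 ^ s)            ≡⟨ twice m (2 ^ s) ⟨
  m * 2 ^ suc s              ∎
  where open ≤-Reasoning

-- If c_i ≤ min(2ℓ, m·2^i) for all i < s and 2ℓ ≤ m·2^s, then
-- 2^{Σ_{i<s} c_i}·ℓ^{6ℓ} ≤ (m·2^s)^{6ℓ}, i.e. Σ c_i ≤ 6ℓ log₂(m·2^s/ℓ).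
exponentBound : ∀ ℓ m s (c : ℕ → ℕ) →
  (∀ i → i < s → c i ≤ 2 * ℓ) → (∀ i → i < s → c i ≤ m * 2 ^ i) → 2 * ℓ ≤ m * 2 ^ s →
  2 ^ ∑ s c * ℓ ^ (6 * ℓ) ≤ (m * 2 ^ s) ^ (6 * ℓ)
exponentBound ℓ m zero c _ _ 2ℓ≤M = saturated 0 ℓ (m * 1) z≤n 2ℓ≤M
exponentBound ℓ m (suc s) c c≤2ℓ c≤m2^i 2ℓ≤M with 2 * ℓ ≤? m * 2 ^ s
... | yes 2ℓ≤M/2 =
  subst₂ (λ e M → 2 ^ e * ℓ ^ (6 * ℓ) ≤ M ^ (6 * ℓ)) (sym (∑-snoc s c)) (sym (twice m (2 ^ s)))
    (doubling (∑ s c) (c s) ℓ (m * 2 ^ s) (≤-trans (c≤2ℓ s (n<1+n s)) (*-monoˡ-≤ ℓ (m≤m+n 2 4)))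
              (exponentBound ℓ m s c (lowerScales c≤2ℓ) (lowerScales c≤m2^i) 2ℓ≤M/2))
... | no 2ℓ≰M/2 = saturated (∑ (suc s) c) ℓ (m * 2 ^ suc s) total≤6ℓ 2ℓ≤M
  where
    open ≤-Reasoning
    total≤6ℓ : ∑ (suc s) c ≤ 6 * ℓ
    total≤6ℓ = begin
      ∑ (suc s) c          ≤⟨ m≤m+n _ m ⟩
      ∑ (suc s) c + m      ≤⟨ geometric m (suc s) c c≤m2^i ⟩
      m * 2 ^ suc s        ≡⟨ twice m (2 ^ s) ⟩
      2 * (m * 2 ^ s)      ≤⟨ *-monoʳ-≤ 2 (<⇒≤ (≰⇒> 2ℓ≰M/2)) ⟩
      2 * (2 * ℓ)          ≡⟨ *-assoc 2 2 ℓ ⟨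
      4 * ℓ                ≤⟨ *-monoˡ-≤ ℓ (m≤m+n 4 2) ⟩
      6 * ℓ                ∎

countL-as-∑ : ∀ (p : ℕ → Bool) (g : ℕ → ℕ) n →
  countL p (applyUpTo g n) ≡ ∑ n (λ x → 𝟙 (p (g x)))
countL-as-∑ p g zero = refl
countL-as-∑ p g (suc n) = cong (𝟙 (p (g 0)) +_) (countL-as-∑ p (λ x → g (suc x)) n)

sumL-as-∑ : ∀ (h g : ℕ → ℕ) n → sumL h (applyUpTo g n) ≡ ∑ n (λ x → h (g x))
sumL-as-∑ h g zero = refl
sumL-as-∑ h g (suc n) = cong (h (g 0) +_) (sumL-as-∑ h (λ x → g (suc x)) n)

at-bounded : ∀ {k} (B : Fin k → Bool) y → k ≤ y → at B y ≡ false
at-bounded {k} B y k≤y with y <? k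
... | yes y<k = ⊥-elim (<⇒≱ y<k k≤y)
... | no _ = refl

module Counts (s : ℕ) (B : Fin (2 ^ s) → Bool) where
  open CubeSet s (at B)

  size≡volume : size B ≡ volume
  size≡volume = countL-as-∑ (at B) (λ y → y) (2 ^ s)

  pathBoundary≡boundary : pathBoundary B ≡ boundary
  pathBoundary≡boundary = countL-as-∑ (λ y → at B y xor at B (suc y)) (λ y → y) K

  cubeBoundary≡∑crossings : cubeBoundary s B ≡ ∑ s crossings
  cubeBoundary≡∑crossings =
    trans (sumL-as-∑ (cubeBoundaryAt s B) (λ i → i) s)
          (∑-cong s (λ i _ → countL-as-∑ _ (λ z → z) (2 ^ s)))

setBound : ∀ s (f : ℕ → Bool) → (∀ y → 2 ^ s ≤ y → f y ≡ false) →
  let open CubeSet s f in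
  0 < volume → 2 * volume ≤ 2 ^ s →
  2 ^ ∑ s crossings * volume ^ (6 * volume) ≤ (boundary * 2 ^ s) ^ (6 * volume)
setBound s f bounded nonempty half =
  exponentBound volume boundary s crossings
    (λ i _ → crossings≤2volume bounded i) crossings≤boundary 2ℓ≤m2^s
  where
    open CubeSet s f
    proper : volume < 2 ^ s
    proper = <-≤-trans (m<m+n volume (subst (0 <_) (sym (+-identityʳ volume)) nonempty)) half
    2ℓ≤m2^s : 2 * volume ≤ boundary * 2 ^ s
    2ℓ≤m2^s = begin
      2 * volume        ≤⟨ half ⟩
      2 ^ s             ≡⟨ *-identityˡ (2 ^ s) ⟨
      1 * 2 ^ s         ≤⟨ *-monoˡ-≤ (2 ^ s) (boundary-pos nonempty proper) ⟩
      boundary * 2 ^ s  ∎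
      where open ≤-Reasoning

subsetBound : (s : ℕ) (B : Fin (2 ^ s) → Bool) → 0 < size B → 2 * size B ≤ 2 ^ s →
  2 ^ cubeBoundary s B * size B ^ (6 * size B) ≤ (pathBoundary B * 2 ^ s) ^ (6 * size B)
subsetBound s B
  with size B | Counts.size≡volume s B
     | pathBoundary B | Counts.pathBoundary≡boundary s B
     | cubeBoundary s B | Counts.cubeBoundary≡∑crossings s B
... | _ | refl | _ | refl | _ | refl = setBound s (at B) (at-bounded B)

proposition1 : (s n' : ℕ) (A : (Fin (suc n') → Fin (2 ^ s)) → Bool)
    (j : Fin (suc n')) (x : Fin n' → Fin (2 ^ s)) →
    0 < size (fibre A j x) →
    2 * size (fibre A j x) ≤ 2 ^ s →
    2 ^ cubeBoundary s (fibre A j x) * size (fibre A j x) ^ (6 * size (fibre A j x))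
    ≤ (pathBoundary (fibre A j x) * 2 ^ s) ^ (6 * size (fibre A j x))
proposition1 s n' A j x = subsetBound s (fibre A j x)
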